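{- Let $C$ be a contradictory strongly connected component of the implication digraph of a 2-CNF. Then: (1) all variables appearing in $C$ are contradictory; (2) if $C$ is source-like (or sink-like), then it is isolated; (3) if $C'$ is another contradictory SCC (distinct from $C$), then there is no directed path from $C$ to $C'$.
   Context: A 2-CNF on $n$ Boolean variables is a set of clauses, each a disjunction of two literals ($x_i$ or $\overline{x_i}$) of distinct variables, without repeated clauses. Its implication digraph has the $2n$ literals as vertices and, for each clause $k\lor\ell$, arcs $\overline k\to\ell$ and $\overline\ell\to k$. A variable $x$ is contradictory if there are directed paths from $x$ to $\overline x$ and from $\overline x$ to $x$. A strongly connected component (SCC) is a maximal set of vertices any two of which are joined by directed paths in both directions; it is contradictory if it contains a contradictory variable. An SCC is source-like if no arc points into it from a vertex outside it, sink-like if no arc points from it to a vertex outside it, and isolated if both. -}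

module Defs where

open import Level using (0ℓ)
open import Data.Nat using (ℕ)
open import Data.Fin using (Fin)
open import Data.Bool using (Bool; true; false; not)
open import Data.Product using (Σ; ∃; _×_; _,_; proj₁)
open import Data.Sum using (_⊎_)
open import Data.List using (List)
open import Data.List.Membership.Propositional using (_∈_)
open import Data.List.Relation.Unary.All using (All)
open import Data.List.Relation.Unary.Unique.Propositional using (Unique)
open import Relation.Nullary using (¬_)
open import Relation.Unary using (Pred; _⊆_)
open import Relation.Binary.PropositionalEquality using (_≡_; _≢_)
open import Relation.Binary.Construct.Closure.ReflexiveTransitive using (Star)

Lit : ℕ → Set
Lit n = Fin n × Bool

var : ∀ {n} → Lit n → Fin n
var = proj₁

pos neg : ∀ {n} → Fin n → Lit n
pos x = x , true
neg x = x , false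

compl : ∀ {n} → Lit n → Lit n
compl (x , b) = x , not b

Clause : ℕ → Set
Clause n = Lit n × Lit n

record TwoCNF (n : ℕ) : Set where
  field
    clauses  : List (Clause n)
    distinct : All (λ c → var (Data.Product.proj₁ c) ≢ var (Data.Product.proj₂ c)) clauses
    noRepeat : Unique clauses

open TwoCNF public

data Arc {n : ℕ} (F : TwoCNF n) : Lit n → Lit n → Set where
  arc₁ : ∀ {k ℓ} → (k , ℓ) ∈ clauses F → Arc F (compl k) ℓ
  arc₂ : ∀ {k ℓ} → (k , ℓ) ∈ clauses F → Arc F (compl ℓ) k

Path : ∀ {n} (F : TwoCNF n) → Lit n → Lit n → Set
Path F = Star (Arc F)

Contradictory : ∀ {n} (F : TwoCNF n) → Fin n → Set
Contradictory F x = Path F (pos x) (neg x) × Path F (neg x) (pos x)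

VSet : ℕ → Set₁
VSet n = Pred (Lit n) 0ℓ

StronglyConnected : ∀ {n} (F : TwoCNF n) → VSet n → Set
StronglyConnected F C = ∀ {a b} → C a → C b → Path F a b

IsSCC : ∀ {n} (F : TwoCNF n) → VSet n → Set₁
IsSCC F C = StronglyConnected F C ×
  (∀ (D : VSet _) → StronglyConnected F D → C ⊆ D → D ⊆ C)

Appears : ∀ {n} → VSet n → Fin n → Set
Appears C x = C (pos x) ⊎ C (neg x)

ContradictorySet : ∀ {n} (F : TwoCNF n) → VSet n → Set
ContradictorySet F C = ∃ λ x → Appears C x × Contradictory F x

SourceLike : ∀ {n} (F : TwoCNF n) → VSet n → Set
SourceLike F C = ∀ {a b} → ¬ C a → C b → ¬ Arc F a b

SinkLike : ∀ {n} (F : TwoCNF n) → VSet n → Set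
SinkLike F C = ∀ {a b} → C a → ¬ C b → ¬ Arc F a b

Isolated : ∀ {n} (F : TwoCNF n) → VSet n → Set
Isolated F C = SourceLike F C × SinkLike F C

SameSet : ∀ {n} → VSet n → VSet n → Set
SameSet C D = C ⊆ D × D ⊆ C

{-# OPTIONS --safe #-}
-- Contraposition makes the implication digraph skew-symmetric: an arc a → b yields an arc
-- ¬b → ¬a. Hence if some literal u of a strongly connected C reaches ¬u and back, so does
-- every literal v of C (go v → u → ¬u → ¬v), and maximality puts ¬v into C as well. A
-- complement-closed set is source-like iff it is sink-like, since contraposition swaps
-- incoming and outgoing arcs. Finally a path a → b between two contradictory components
-- returns as b → ¬b → ¬a → a, so the two components are strongly connected together and
-- maximality forces them to coincide.
module Submission where

open import Defs
open import Data.Fin using (Fin)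
open import Data.Bool using (true; false)
open import Data.Bool.Properties using (not-involutive)
open import Data.Product using (_×_; ∃; _,_; proj₁; proj₂; swap)
open import Data.Sum using (_⊎_; inj₁; inj₂)
open import Function using (id; _∘′_)
open import Relation.Nullary using (¬_)
open import Relation.Binary.PropositionalEquality using (_≡_; refl; cong; subst)
open import Relation.Binary.Construct.Closure.ReflexiveTransitive using (ε; _◅◅_; gmap; reverse)

compl-involutive : ∀ {n} (a : Lit n) → compl (compl a) ≡ a
compl-involutive (x , b) = cong (x ,_) (not-involutive b)

module _ {n} (F : TwoCNF n) where

  Arc-contrapositive : ∀ {a b} → Arc F a b → Arc F (compl b) (compl a)
  Arc-contrapositive (arc₁ {k = x , true}  k∨ℓ) = arc₂ k∨ℓ
  Arc-contrapositive (arc₁ {k = x , false} k∨ℓ) = arc₂ k∨ℓ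
  Arc-contrapositive (arc₂ {ℓ = x , true}  k∨ℓ) = arc₁ k∨ℓ
  Arc-contrapositive (arc₂ {ℓ = x , false} k∨ℓ) = arc₁ k∨ℓ

  Path-contrapositive : ∀ {a b} → Path F a b → Path F (compl b) (compl a)
  Path-contrapositive = reverse id ∘′ gmap compl Arc-contrapositive

  SelfContradictory : Lit n → Set
  SelfContradictory v = Path F v (compl v) × Path F (compl v) v

  contradictory⇒selfContradictory : ∀ {x b} → Contradictory F x → SelfContradictory (x , b)
  contradictory⇒selfContradictory {b = true}  x↔¬x = x↔¬x
  contradictory⇒selfContradictory {b = false} x↔¬x = swap x↔¬x

  selfContradictory⇒contradictory : ∀ {x b} → SelfContradictory (x , b) → Contradictory F x
  selfContradictory⇒contradictory {b = true}  v↔¬v = v↔¬v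
  selfContradictory⇒contradictory {b = false} v↔¬v = swap v↔¬v

  contradictorySet-witness : ∀ {C} → ContradictorySet F C → ∃ λ u → C u × SelfContradictory u
  contradictorySet-witness (x , inj₁ Cx  , x↔¬x) = pos x , Cx  , contradictory⇒selfContradictory x↔¬x
  contradictorySet-witness (x , inj₂ C¬x , x↔¬x) = neg x , C¬x , contradictory⇒selfContradictory x↔¬x

  selfContradictory-transfer : ∀ {u v} → Path F u v → Path F v u →
                               SelfContradictory u → SelfContradictory v
  selfContradictory-transfer u→v v→u (u→¬u , ¬u→u) =
      v→u ◅◅ u→¬u ◅◅ Path-contrapositive v→u
    , Path-contrapositive u→v ◅◅ ¬u→u ◅◅ u→v

  stronglyConnected-selfContradictory : ∀ {C} → StronglyConnected F C → ContradictorySet F C →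
                                        ∀ {v} → C v → SelfContradictory v
  stronglyConnected-selfContradictory {C} sc cs Cv =
    let u , Cu , u↔¬u = contradictorySet-witness {C} cs
    in selfContradictory-transfer (sc Cu Cv) (sc Cv Cu) u↔¬u

  IsSCC-merge : ∀ {C D a b} → IsSCC F C → IsSCC F D → C a → D b →
                Path F a b → Path F b a → SameSet C D
  IsSCC-merge {C} {D} (scC , maxC) (scD , maxD) Ca Db a→b b→a =
    (λ Cz → maxD C∪D sc∪ inj₂ (inj₁ Cz)) , (λ Dz → maxC C∪D sc∪ inj₁ (inj₂ Dz))
    where
      C∪D : VSet n
      C∪D z = C z ⊎ D z
      sc∪ : StronglyConnected F C∪D
      sc∪ (inj₁ Cx) (inj₁ Cy) = scC Cx Cy
      sc∪ (inj₁ Cx) (inj₂ Dy) = scC Cx Ca ◅◅ a→b ◅◅ scD Db Dy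
      sc∪ (inj₂ Dx) (inj₁ Cy) = scD Dx Db ◅◅ b→a ◅◅ scC Ca Cy
      sc∪ (inj₂ Dx) (inj₂ Dy) = scD Dx Dy

  stronglyConnected-contradictory : ∀ {C} → StronglyConnected F C → ContradictorySet F C →
                                    ∀ x → Appears C x → Contradictory F x
  stronglyConnected-contradictory sc cs x (inj₁ Cx) =
    selfContradictory⇒contradictory (stronglyConnected-selfContradictory sc cs Cx)
  stronglyConnected-contradictory sc cs x (inj₂ C¬x) =
    selfContradictory⇒contradictory (stronglyConnected-selfContradictory sc cs C¬x)

  contradictorySCC-noPath : ∀ {C D} → IsSCC F C → ContradictorySet F C →
                            IsSCC F D → ContradictorySet F D → ¬ SameSet C D →
                            ∀ {a b} → C a → D b → ¬ Path F a b
  contradictorySCC-noPath sccC csC sccD csD C≢D {a} {b} Ca Db a→b =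
    C≢D (IsSCC-merge sccC sccD Ca Db a→b b→a)
    where
      b→a : Path F b a
      b→a = proj₁ (stronglyConnected-selfContradictory (proj₁ sccD) csD Db)
         ◅◅ Path-contrapositive a→b
         ◅◅ proj₂ (stronglyConnected-selfContradictory (proj₁ sccC) csC Ca)

  IsSCC-compl-closed : ∀ {C} → IsSCC F C → (∀ {v} → C v → SelfContradictory v) →
                       ∀ {a} → C a → C (compl a)
  IsSCC-compl-closed {C} (sc , max) self {a} Ca = max C∪¬a sc∪ inj₁ (inj₂ refl)
    where
      C∪¬a : VSet n
      C∪¬a z = C z ⊎ z ≡ compl a
      sc∪ : StronglyConnected F C∪¬a
      sc∪ (inj₁ Cx)   (inj₁ Cy)   = sc Cx Cy
      sc∪ (inj₁ Cx)   (inj₂ refl) = sc Cx Ca ◅◅ proj₁ (self Ca)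
      sc∪ (inj₂ refl) (inj₁ Cy)   = proj₂ (self Ca) ◅◅ sc Ca Cy
      sc∪ (inj₂ refl) (inj₂ refl) = ε

  module _ {C : VSet n} (closed : ∀ {a} → C a → C (compl a)) where

    compl-closed-complement : ∀ {b} → ¬ C b → ¬ C (compl b)
    compl-closed-complement {b} ¬Cb C¬b = ¬Cb (subst C (compl-involutive b) (closed C¬b))

    sourceLike⇒sinkLike : SourceLike F C → SinkLike F C
    sourceLike⇒sinkLike source Ca ¬Cb a→b =
      source (compl-closed-complement ¬Cb) (closed Ca) (Arc-contrapositive a→b)

    sinkLike⇒sourceLike : SinkLike F C → SourceLike F C
    sinkLike⇒sourceLike sink ¬Ca Cb a→b =
      sink (closed Cb) (compl-closed-complement ¬Ca) (Arc-contrapositive a→b)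

    sourceLike⊎sinkLike⇒isolated : SourceLike F C ⊎ SinkLike F C → Isolated F C
    sourceLike⊎sinkLike⇒isolated (inj₁ source) = source , sourceLike⇒sinkLike source
    sourceLike⊎sinkLike⇒isolated (inj₂ sink)   = sinkLike⇒sourceLike sink , sink

mainTheorem6 : ∀ {n} (F : TwoCNF n) (C : VSet n) → IsSCC F C → ContradictorySet F C →
    ((∀ (x : Fin n) → Appears C x → Contradictory F x)
    × ((SourceLike F C ⊎ SinkLike F C) → Isolated F C)
    × (∀ (C' : VSet n) → IsSCC F C' → ContradictorySet F C' → ¬ SameSet C C' →
    ∀ {a b} → C a → C' b → ¬ Path F a b))
mainTheorem6 F C scc cs =
    stronglyConnected-contradictory F (proj₁ scc) cs
  , sourceLike⊎sinkLike⇒isolated F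
      (IsSCC-compl-closed F scc (stronglyConnected-selfContradictory F (proj₁ scc) cs))
  , λ C' scc' cs' → contradictorySCC-noPath F scc cs scc' cs'
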